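{- For every $n\ge1$ there exists a non-adaptive set $\mathcal{Q}$ of $n+2$ query sequences, each of length at most $n$ and using only $\mathcal{O}(1)$ extra characters (real numbers outside $\{0,1\}$), and an algorithm that, for any input sequence $s\in\{0,1\}^{\ell}$ with $0\le\ell\le n$, exactly recovers $s$ from the values $d_{\mathrm{DTW}}(s,q)$, $q\in\mathcal{Q}$.
   Context: An expansion of a sequence $x$ is any sequence obtained from $x$ by replacing each character by one or more consecutive copies of itself. For sequences $x,y$ of real numbers, $d_{\mathrm{DTW}}(x,y)=\min\|\bar x-\bar y\|_1$ over all pairs $(\bar x,\bar y)$ of equal-length expansions. Non-adaptive: the queries are fixed independently of $s$; the length of $s$ is unknown. -}

module Defs where

open import Data.Nat using (ℕ)
open import Data.Bool using (Bool; true; false)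
open import Data.List using (List; []; _∷_; map; length)
open import Data.Maybe using (Maybe; just; nothing)
open import Data.Product using (Σ; ∃; _×_; _,_)
open import Data.Rational using (ℚ; 0ℚ; 1ℚ; _+_; _-_; ∣_∣; _≤_)
open import Relation.Binary.PropositionalEquality using (_≡_)
open import Relation.Nullary using (¬_)

-- Expansion ys of xs: each character of xs replaced by one or more
-- consecutive copies of itself.
data Expansion : List ℚ → List ℚ → Set where
  done  : Expansion [] []
  stay  : ∀ {x xs ys} → Expansion (x ∷ xs) ys → Expansion (x ∷ xs) (x ∷ ys)
  step  : ∀ {x xs ys} → Expansion xs ys → Expansion (x ∷ xs) (x ∷ ys)

-- L1 distance of two lists (used only on lists of equal length)
l1 : List ℚ → List ℚ → ℚ
l1 (a ∷ as) (b ∷ bs) = ∣ a - b ∣ + l1 as bs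
l1 _ _ = 0ℚ

record ExpPair (x y : List ℚ) : Set where
  constructor expPair
  field
    xb yb   : List ℚ
    xexp    : Expansion x xb
    yexp    : Expansion y yb
    eqLen   : length xb ≡ length yb

open ExpPair public

-- IsDTW x y d : d is d_DTW(x,y), i.e. the minimum of ‖x̄ - ȳ‖₁ over all
-- pairs of equal-length expansions; nothing encodes +∞ (the minimum over
-- an empty set, which happens exactly when one of x, y is empty and the
-- other is not).
IsDTW : List ℚ → List ℚ → Maybe ℚ → Set
IsDTW x y (just d) =
  (Σ (ExpPair x y) λ p → l1 (xb p) (yb p) ≡ d) ×
  (∀ (p : ExpPair x y) → d ≤ l1 (xb p) (yb p))
IsDTW x y nothing = ¬ ExpPair x y

bit : Bool → ℚ
bit false = 0ℚ
bit true  = 1ℚ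

toSeq : List Bool → List ℚ
toSeq = map bit

{-# OPTIONS --safe #-}
module Submission where

open import Defs
open import Algebra.Properties.Group using (∙-cancelˡ)
open import Data.Bool using (Bool; true; false)
open import Data.Fin using (Fin; toℕ; fromℕ<)
open import Data.Fin.Properties using (toℕ-fromℕ<; all?)
open import Data.List using (List; []; _∷_; _++_; _∷ʳ_; length; map; replicate; find)
open import Data.List.Properties using (length-map; length-replicate; length-++)
open import Data.List.Membership.Propositional using (_∈_)
open import Data.List.Membership.Propositional.Properties using (∈-map⁺; ∈-++⁺ˡ; ∈-++⁺ʳ)
open import Data.List.Relation.Unary.All using (All; universal)
open import Data.List.Relation.Unary.All.Properties using (map⁺)
open import Data.List.Relation.Unary.Any using (here; there)
open import Data.Maybe using (Maybe; just; nothing; fromMaybe)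
open import Data.Maybe.Properties using (just-injective; ≡-dec)
open import Data.Nat using (ℕ; zero; suc; z≤n; s≤s; _+_; _*_; _≤_; _<_; _<?_; _≤?_)
open import Data.Nat.Properties
  using (≤-refl; ≤-trans; ≤-<-trans; ≤-reflexive; <⇒≤; <⇒≱; ≮⇒≥; m≤n⇒m≤1+n; m≤n+m; m<m+n;
         +-monoʳ-≤; +-monoˡ-≤; +-assoc; +-comm; +-cancelˡ-≡; *-cancelʳ-≡; suc-injective; m≢1+n+m)
open import Data.Nat.Solver using (module +-*-Solver)
open import Data.Product using (Σ; ∃; _×_; _,_; proj₁)
open import Data.Rational using (ℚ; 0ℚ; 1ℚ)
import Data.Rational as ℚ
import Data.Rational.Properties as ℚ
open import Data.Sum using (_⊎_; inj₁; inj₂)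
open import Function using (_∘_)
open import Relation.Binary.PropositionalEquality
  using (_≡_; _≢_; refl; sym; trans; cong; cong₂; subst; module ≡-Reasoning)
open import Relation.Nullary using (yes; no; contradiction)
open import Relation.Nullary.Decidable using (_⊎-dec_; _×-dec_; _→-dec_)
open import Relation.Unary using (Pred; Decidable)
open +-*-Solver using (solve; _:+_; _:=_)

-- The queries use the extra letters 2 and −2. Against a bit b, 2 costs 2 − b and −2 costs
-- 2 + b; as −2 costs at least 2 and at most 2 more than 2, stretching s or matching a
-- bit against a repeated letter never lowers the cost, and for k < |s| the distance to
-- (−2)^k 2 is σ_k(s) = Σ_{i<k} (2 + s_i) + Σ_{i≥k} (2 − s_i), while the distance to −2 is
-- Σ_i (2 + s_i) = σ_k(s) for every k ≥ |s|. The distances for k = 0 and to −2 add up to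
-- 4|s|, which gives |s| and hence σ_k(s) for every k; consecutive σ_k differ by 2 s_k.

data Expands {A : Set} : List A → List A → Set where
  done : Expands [] []
  stay : ∀ {x xs ys} → Expands (x ∷ xs) ys → Expands (x ∷ xs) (x ∷ ys)
  step : ∀ {x xs ys} → Expands xs ys → Expands (x ∷ xs) (x ∷ ys)

Expands-refl : ∀ {A : Set} (xs : List A) → Expands xs xs
Expands-refl [] = done
Expands-refl (x ∷ xs) = step (Expands-refl xs)

Expands-replicate : ∀ {A : Set} (x : A) n → Expands (x ∷ []) (replicate (suc n) x)
Expands-replicate x zero = step done
Expands-replicate x (suc n) = stay (Expands-replicate x n)

Expansion-map⁺ : ∀ {A : Set} (f : A → ℚ) {xs ys} → Expands xs ys → Expansion (map f xs) (map f ys)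
Expansion-map⁺ f done = done
Expansion-map⁺ f (stay e) = stay (Expansion-map⁺ f e)
Expansion-map⁺ f (step e) = step (Expansion-map⁺ f e)

Expansion-map⁻ : ∀ {A : Set} (f : A → ℚ) xs {ys} → Expansion (map f xs) ys →
                 ∃ λ zs → ys ≡ map f zs × Expands xs zs
Expansion-map⁻ f [] done = [] , refl , done
Expansion-map⁻ f (x ∷ xs) (stay e) with Expansion-map⁻ f (x ∷ xs) e
... | zs , refl , e′ = x ∷ zs , refl , stay e′
Expansion-map⁻ f (x ∷ xs) (step e) with Expansion-map⁻ f xs e
... | zs , refl , e′ = x ∷ zs , refl , step e′

Expansion⇒length-≤ : ∀ {xs ys} → Expansion xs ys → length xs ≤ length ys
Expansion⇒length-≤ done = z≤n
Expansion⇒length-≤ (stay e) = m≤n⇒m≤1+n (Expansion⇒length-≤ e)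
Expansion⇒length-≤ (step e) = s≤s (Expansion⇒length-≤ e)

toℚ : ℕ → ℚ
toℚ zero = 0ℚ
toℚ (suc n) = 1ℚ ℚ.+ toℚ n

toℚ-+ : ∀ m n → toℚ (m + n) ≡ toℚ m ℚ.+ toℚ n
toℚ-+ zero n = sym (ℚ.+-identityˡ (toℚ n))
toℚ-+ (suc m) n = trans (cong (1ℚ ℚ.+_) (toℚ-+ m n)) (sym (ℚ.+-assoc 1ℚ (toℚ m) (toℚ n)))

toℚ-nonNeg : ∀ n → 0ℚ ℚ.≤ toℚ n
toℚ-nonNeg zero = ℚ.≤-refl
toℚ-nonNeg (suc n) = ℚ.+-mono-≤ (ℚ.nonNegative⁻¹ 1ℚ) (toℚ-nonNeg n)

toℚ-mono-≤ : ∀ {m n} → m ≤ n → toℚ m ℚ.≤ toℚ n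
toℚ-mono-≤ {n = n} z≤n = toℚ-nonNeg n
toℚ-mono-≤ (s≤s m≤n) = ℚ.+-monoʳ-≤ 1ℚ (toℚ-mono-≤ m≤n)

0≢toℚ-suc : ∀ n → 0ℚ ≢ toℚ (suc n)
0≢toℚ-suc n = ℚ.<⇒≢ (ℚ.+-mono-<-≤ (ℚ.positive⁻¹ 1ℚ) (toℚ-nonNeg n))

toℚ-injective : ∀ {m n} → toℚ m ≡ toℚ n → m ≡ n
toℚ-injective {zero} {zero} _ = refl
toℚ-injective {zero} {suc n} eq = contradiction eq (0≢toℚ-suc n)
toℚ-injective {suc m} {zero} eq = contradiction (sym eq) (0≢toℚ-suc m)
toℚ-injective {suc m} {suc n} eq =
  cong suc (toℚ-injective (∙-cancelˡ ℚ.+-0-group 1ℚ (toℚ m) (toℚ n) eq))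

data Mark : Set where
  neg pos : Mark

mark : Mark → ℚ
mark neg = ℚ.- toℚ 2
mark pos = toℚ 2

cost : Bool → Mark → ℕ
cost false _ = 2
cost true neg = 3
cost true pos = 1

∣bit-mark∣ : ∀ b m → ℚ.∣ bit b ℚ.- mark m ∣ ≡ toℚ (cost b m)
∣bit-mark∣ false neg = refl
∣bit-mark∣ false pos = refl
∣bit-mark∣ true neg = refl
∣bit-mark∣ true pos = refl

pairCost : List Bool → List Mark → ℕ
pairCost (x ∷ xs) (m ∷ ms) = cost x m + pairCost xs ms
pairCost _ _ = 0

l1≡pairCost : ∀ xs ms → l1 (toSeq xs) (map mark ms) ≡ toℚ (pairCost xs ms)
l1≡pairCost [] ms = refl
l1≡pairCost (x ∷ xs) [] = refl
l1≡pairCost (x ∷ xs) (m ∷ ms) =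
  trans (cong₂ ℚ._+_ (∣bit-mark∣ x m) (l1≡pairCost xs ms)) (sym (toℚ-+ (cost x m) (pairCost xs ms)))

Attains : List Bool → List Mark → ℕ → Set
Attains s q v = ∃ λ ys → Expands q ys × length s ≡ length ys × pairCost s ys ≡ v

record DiscreteDTW (s : List Bool) (q : List Mark) (v : ℕ) : Set where
  field
    attained : Attains s q v
    minimal  : ∀ {xs ys} → Expands s xs → Expands q ys → length xs ≡ length ys → v ≤ pairCost xs ys

IsDTW-just : ∀ {x y d} v → (Σ (ExpPair x y) λ p → l1 (xb p) (yb p) ≡ v) →
             (∀ (p : ExpPair x y) → v ℚ.≤ l1 (xb p) (yb p)) → IsDTW x y d → d ≡ just v
IsDTW-just {d = nothing} v (p , _) _ noPair = contradiction p noPair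
IsDTW-just {d = just d} v (p₀ , v≡) v≤ ((p , d≡) , d≤) =
  cong just (ℚ.≤-antisym (subst (d ℚ.≤_) v≡ (d≤ p₀)) (subst (v ℚ.≤_) d≡ (v≤ p)))

IsDTW-[]ˡ : ∀ {y d} → 1 ≤ length y → IsDTW [] y d → d ≡ nothing
IsDTW-[]ˡ {d = nothing} _ _ = refl
IsDTW-[]ˡ {d = just _} 1≤y ((expPair _ _ done ye eq , _) , _) =
  contradiction (≤-trans 1≤y (≤-trans (Expansion⇒length-≤ ye) (≤-reflexive (sym eq)))) λ ()

DiscreteDTW⇒IsDTW : ∀ {s q v d} → DiscreteDTW s q v →
                    IsDTW (toSeq s) (map mark q) d → d ≡ just (toℚ v)
DiscreteDTW⇒IsDTW {s} {q} {v} dtw = IsDTW-just (toℚ v) witness lowerBound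
  where
  open DiscreteDTW dtw
  witness : Σ (ExpPair (toSeq s) (map mark q)) λ p → l1 (xb p) (yb p) ≡ toℚ v
  witness with attained
  ... | ys , q↝ys , len , cost≡ =
    expPair (toSeq s) (map mark ys) (Expansion-map⁺ bit (Expands-refl s)) (Expansion-map⁺ mark q↝ys)
            (trans (length-map bit s) (trans len (sym (length-map mark ys)))) ,
    trans (l1≡pairCost s ys) (cong toℚ cost≡)
  lowerBound : ∀ p → toℚ v ℚ.≤ l1 (xb p) (yb p)
  lowerBound (expPair _ _ s↝ q↝ len)
    with Expansion-map⁻ bit s s↝ | Expansion-map⁻ mark q q↝
  ... | xs , refl , s↝xs | ys , refl , q↝ys =
    subst (toℚ v ℚ.≤_) (sym (l1≡pairCost xs ys))
      (toℚ-mono-≤ (minimal s↝xs q↝ys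
        (trans (sym (length-map bit xs)) (trans len (length-map mark ys)))))

cost-pos≤neg : ∀ b → cost b pos ≤ cost b neg
cost-pos≤neg false = ≤-refl
cost-pos≤neg true = s≤s z≤n

cost-neg≤2+pos : ∀ b → cost b neg ≤ 2 + cost b pos
cost-neg≤2+pos false = s≤s (s≤s z≤n)
cost-neg≤2+pos true = ≤-refl

2≤cost-neg : ∀ b → 2 ≤ cost b neg
2≤cost-neg false = ≤-refl
2≤cost-neg true = s≤s (s≤s z≤n)

cost-pos+neg : ∀ b → cost b pos + cost b neg ≡ 4
cost-pos+neg false = refl
cost-pos+neg true = refl

uniformCost : Mark → List Bool → ℕ
uniformCost m [] = 0
uniformCost m (x ∷ s) = cost x m + uniformCost m s

uniformCost-expand : ∀ m {s xs} → Expands s xs → uniformCost m s ≤ uniformCost m xs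
uniformCost-expand m done = ≤-refl
uniformCost-expand m (stay {x} {s} e) =
  +-monoʳ-≤ (cost x m) (≤-trans (m≤n+m (uniformCost m s) (cost x m)) (uniformCost-expand m e))
uniformCost-expand m (step {x} e) = +-monoʳ-≤ (cost x m) (uniformCost-expand m e)

pairCost-uniform : ∀ m xs {ys} → Expands (m ∷ []) ys → length xs ≡ length ys →
                   pairCost xs ys ≡ uniformCost m xs
pairCost-uniform m (x ∷ xs) (stay e) len = cong (cost x m +_) (pairCost-uniform m xs e (suc-injective len))
pairCost-uniform m (x ∷ []) (step done) refl = refl

uniformCost-attained : ∀ m x s → Attains (x ∷ s) (m ∷ []) (uniformCost m (x ∷ s))
uniformCost-attained m x s =
  replicate ℓ m , m↝ys , sym (length-replicate ℓ) ,
  pairCost-uniform m (x ∷ s) m↝ys (sym (length-replicate ℓ))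
  where
  ℓ = length (x ∷ s)
  m↝ys = Expands-replicate m (length s)

uniformCost-DTW : ∀ m x s → DiscreteDTW (x ∷ s) (m ∷ []) (uniformCost m (x ∷ s))
uniformCost-DTW m x s = record
  { attained = uniformCost-attained m x s
  ; minimal  = λ {xs} s↝xs m↝ys len →
      ≤-trans (uniformCost-expand m s↝xs) (≤-reflexive (sym (pairCost-uniform m xs m↝ys len)))
  }

uniformCost-pos+neg : ∀ s → uniformCost pos s + uniformCost neg s ≡ length s * 4
uniformCost-pos+neg [] = refl
uniformCost-pos+neg (x ∷ s) = begin
  (cost x pos + uniformCost pos s) + (cost x neg + uniformCost neg s)
    ≡⟨ +-interchange (cost x pos) (uniformCost pos s) (cost x neg) (uniformCost neg s) ⟩
  (cost x pos + cost x neg) + (uniformCost pos s + uniformCost neg s)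
    ≡⟨ cong₂ _+_ (cost-pos+neg x) (uniformCost-pos+neg s) ⟩
  4 + length s * 4 ∎
  where
  open ≡-Reasoning
  +-interchange : ∀ a b c d → (a + b) + (c + d) ≡ (a + c) + (b + d)
  +-interchange = solve 4 (λ a b c d → (a :+ b) :+ (c :+ d) := (a :+ c) :+ (b :+ d)) refl

stepQuery : ℕ → List Mark
stepQuery k = replicate k neg ∷ʳ pos

splitCost : ℕ → List Bool → ℕ
splitCost zero s = uniformCost pos s
splitCost (suc k) [] = 0
splitCost (suc k) (x ∷ s) = cost x neg + splitCost k s

splitCost-≤-suc : ∀ k s → splitCost k s ≤ splitCost (suc k) s
splitCost-≤-suc zero [] = z≤n
splitCost-≤-suc zero (x ∷ s) = +-monoˡ-≤ (uniformCost pos s) (cost-pos≤neg x)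
splitCost-≤-suc (suc k) [] = z≤n
splitCost-≤-suc (suc k) (x ∷ s) = +-monoʳ-≤ (cost x neg) (splitCost-≤-suc k s)

splitCost-suc≤2+ : ∀ k s → splitCost (suc k) s ≤ 2 + splitCost k s
splitCost-suc≤2+ zero [] = z≤n
splitCost-suc≤2+ zero (x ∷ s) =
  ≤-trans (+-monoˡ-≤ (uniformCost pos s) (cost-neg≤2+pos x))
          (≤-reflexive (+-assoc 2 (cost x pos) (uniformCost pos s)))
splitCost-suc≤2+ (suc k) [] = z≤n
splitCost-suc≤2+ (suc k) (x ∷ s) =
  ≤-trans (+-monoʳ-≤ (cost x neg) (splitCost-suc≤2+ k s))
          (≤-reflexive (+-left-comm (cost x neg) 2 (splitCost k s)))
  where
  +-left-comm : ∀ a b c → a + (b + c) ≡ b + (a + c)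
  +-left-comm = solve 3 (λ a b c → a :+ (b :+ c) := b :+ (a :+ c)) refl

splitCost-∷ : ∀ k x s → splitCost k s ≤ splitCost k (x ∷ s)
splitCost-∷ zero x s = m≤n+m (uniformCost pos s) (cost x pos)
splitCost-∷ (suc k) x s = ≤-trans (splitCost-suc≤2+ k s) (+-monoˡ-≤ (splitCost k s) (2≤cost-neg x))

splitCost-expand : ∀ k {s xs} → Expands s xs → splitCost k s ≤ splitCost k xs
splitCost-expand k done = ≤-refl
splitCost-expand zero (stay {x} {s} e) =
  +-monoʳ-≤ (cost x pos) (≤-trans (splitCost-∷ zero x s) (splitCost-expand zero e))
splitCost-expand (suc k) (stay {x} {s} e) =
  +-monoʳ-≤ (cost x neg) (≤-trans (splitCost-∷ k x s) (splitCost-expand k e))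
splitCost-expand zero (step {x} e) = +-monoʳ-≤ (cost x pos) (splitCost-expand zero e)
splitCost-expand (suc k) (step {x} e) = +-monoʳ-≤ (cost x neg) (splitCost-expand k e)

splitCost≤pairCost : ∀ k xs {ys} → Expands (stepQuery k) ys → length xs ≡ length ys →
                     splitCost k xs ≤ pairCost xs ys
splitCost≤pairCost zero xs q↝ys len = ≤-reflexive (sym (pairCost-uniform pos xs q↝ys len))
splitCost≤pairCost (suc k) (x ∷ xs) (stay q↝ys) len =
  +-monoʳ-≤ (cost x neg)
    (≤-trans (splitCost-≤-suc k xs) (splitCost≤pairCost (suc k) xs q↝ys (suc-injective len)))
splitCost≤pairCost (suc k) (x ∷ xs) (step q↝ys) len =
  +-monoʳ-≤ (cost x neg) (splitCost≤pairCost k xs q↝ys (suc-injective len))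

splitCost-attained : ∀ k s → k < length s → Attains s (stepQuery k) (splitCost k s)
splitCost-attained zero (x ∷ s) _ = uniformCost-attained pos x s
splitCost-attained (suc k) (x ∷ s) (s≤s k<ℓ) with splitCost-attained k s k<ℓ
... | ys , q↝ys , len , cost≡ = neg ∷ ys , step q↝ys , cong suc len , cong (cost x neg +_) cost≡

splitCost-DTW : ∀ k s → k < length s → DiscreteDTW s (stepQuery k) (splitCost k s)
splitCost-DTW k s k<ℓ = record
  { attained = splitCost-attained k s k<ℓ
  ; minimal  = λ {xs} s↝xs q↝ys len →
      ≤-trans (splitCost-expand k s↝xs) (splitCost≤pairCost k xs q↝ys len)
  }

splitCost-≥length : ∀ k s → length s ≤ k → splitCost k s ≡ uniformCost neg s
splitCost-≥length zero [] _ = refl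
splitCost-≥length (suc k) [] _ = refl
splitCost-≥length (suc k) (x ∷ s) (s≤s ℓ≤k) = cong (cost x neg +_) (splitCost-≥length k s ℓ≤k)

head-determined : ∀ x y {A B} →
                  cost x pos + A ≡ cost y pos + B → cost x neg + A ≡ cost y neg + B → x ≡ y
head-determined false false _ _ = refl
head-determined true true _ _ = refl
head-determined false true {B = B} eq₁ eq₂ = contradiction (suc-injective (trans (sym eq₁) eq₂)) (m≢1+n+m B)
head-determined true false {A} eq₁ eq₂ = contradiction (suc-injective (trans eq₁ (sym eq₂))) (m≢1+n+m A)

≡-from-splitCosts : ∀ s t → length s ≡ length t → (∀ k → splitCost k s ≡ splitCost k t) → s ≡ t
≡-from-splitCosts [] [] _ _ = refl
≡-from-splitCosts (x ∷ s) (y ∷ t) len eq with head-determined x y (eq 0) (eq 1)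
... | refl = cong (x ∷_) (≡-from-splitCosts s t (suc-injective len)
                            (λ k → +-cancelˡ-≡ (cost x neg) _ _ (eq (suc k))))

splitCost-injective : ∀ {s t} →
                      uniformCost pos s ≡ uniformCost pos t → uniformCost neg s ≡ uniformCost neg t →
                      (∀ k → k < length s → k < length t → splitCost k s ≡ splitCost k t) → s ≡ t
splitCost-injective {s} {t} pos≡ neg≡ agree = ≡-from-splitCosts s t len≡ splitCost≡
  where
  len≡ : length s ≡ length t
  len≡ = *-cancelʳ-≡ (length s) (length t) 4
    (trans (sym (uniformCost-pos+neg s)) (trans (cong₂ _+_ pos≡ neg≡) (uniformCost-pos+neg t)))
  splitCost≡ : ∀ k → splitCost k s ≡ splitCost k t
  splitCost≡ k with k <? length s
  ... | yes k<s = agree k k<s (subst (k <_) len≡ k<s)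
  ... | no k≮s = begin
    splitCost k s     ≡⟨ splitCost-≥length k s (≮⇒≥ k≮s) ⟩
    uniformCost neg s ≡⟨ neg≡ ⟩
    uniformCost neg t ≡⟨ splitCost-≥length k t (subst (_≤ k) len≡ (≮⇒≥ k≮s)) ⟨
    splitCost k t     ∎
    where open ≡-Reasoning

length-stepQuery : ∀ k → length (stepQuery k) ≡ suc k
length-stepQuery k =
  trans (length-++ (replicate k neg)) (trans (cong (_+ 1) (length-replicate k)) (+-comm k 1))

query : ℕ → ℕ → List Mark
query n k with k <? n
... | yes _ = stepQuery k
... | no _  = neg ∷ []

1≤length-query : ∀ n k → 1 ≤ length (query n k)
1≤length-query n k with k <? n
... | yes _ = subst (1 ≤_) (sym (length-stepQuery k)) (s≤s z≤n)
... | no _  = s≤s z≤n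

length-query≤ : ∀ {n} k → 1 ≤ n → length (query n k) ≤ n
length-query≤ {n} k 1≤n with k <? n
... | yes k<n = subst (_≤ n) (sym (length-stepQuery k)) k<n
... | no _    = 1≤n

-- For |s| ≤ k < n the distance to (−2)^k 2 is not σ_k(s); the decoder ignores those queries.
Determined : ℕ → List Bool → ℕ → Set
Determined n s k = k < length s ⊎ n ≤ k

predictedDTW : ℕ → List Bool → Maybe ℚ
predictedDTW k [] = nothing
predictedDTW k s@(_ ∷ _) = just (toℚ (splitCost k s))

query-DTW : ∀ {n s k d} → length s ≤ n → Determined n s k →
            IsDTW (toSeq s) (map mark (query n k)) d → d ≡ predictedDTW k s
query-DTW {n} {[]} {k} _ _ dtw =
  IsDTW-[]ˡ (subst (1 ≤_) (sym (length-map mark (query n k))) (1≤length-query n k)) dtw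
query-DTW {n} {s@(x ∷ s′)} {k} s≤n det dtw with k <? n
... | yes k<n = DiscreteDTW⇒IsDTW (splitCost-DTW k s (k<length det)) dtw
  where
  k<length : Determined n s k → k < length s
  k<length (inj₁ k<s) = k<s
  k<length (inj₂ n≤k) = contradiction n≤k (<⇒≱ k<n)
... | no k≮n = trans (DiscreteDTW⇒IsDTW (uniformCost-DTW neg x s′) dtw)
                     (cong (just ∘ toℚ) (sym (splitCost-≥length k s (≤-trans s≤n (≮⇒≥ k≮n)))))

Consistent : (n : ℕ) → (Fin (n + 2) → Maybe ℚ) → List Bool → Set
Consistent n ds s = length s ≤ n × (∀ i → Determined n s (toℕ i) → ds i ≡ predictedDTW (toℕ i) s)

consistent? : ∀ n ds → Decidable (Consistent n ds)
consistent? n ds s = (length s ≤? n) ×-dec all? λ i →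
  ((toℕ i <? length s) ⊎-dec (n ≤? toℕ i)) →-dec ≡-dec ℚ._≟_ (ds i) (predictedDTW (toℕ i) s)

DTW-consistent : ∀ {n s} ds → length s ≤ n →
                 (∀ i → IsDTW (toSeq s) (map mark (query n (toℕ i))) (ds i)) → Consistent n ds s
DTW-consistent ds s≤n dtw = s≤n , λ i det → query-DTW s≤n det (dtw i)

index : ∀ {n k} → k ≤ n → Fin (n + 2)
index {n} k≤n = fromℕ< (≤-<-trans k≤n (m<m+n n (s≤s z≤n)))

toℕ-index : ∀ {n k} (k≤n : k ≤ n) → toℕ (index k≤n) ≡ k
toℕ-index {n} k≤n = toℕ-fromℕ< (≤-<-trans k≤n (m<m+n n (s≤s z≤n)))

Consistent⇒observed : ∀ {n ds s} → Consistent n ds s →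
                      ∀ {k} (k≤n : k ≤ n) → Determined n s k → ds (index k≤n) ≡ predictedDTW k s
Consistent⇒observed {n} {ds} {s} (_ , obs) k≤n det =
  subst (λ j → ds (index k≤n) ≡ predictedDTW j s) (toℕ-index k≤n)
        (obs (index k≤n) (subst (Determined n s) (sym (toℕ-index k≤n)) det))

Consistent-agree : ∀ {n ds s t} → Consistent n ds s → Consistent n ds t → ∀ {k} → k ≤ n →
                   Determined n s k → Determined n t k → predictedDTW k s ≡ predictedDTW k t
Consistent-agree cs ct k≤n detS detT =
  trans (sym (Consistent⇒observed cs k≤n detS)) (Consistent⇒observed ct k≤n detT)

consistent-unique : ∀ {n ds} s t → Consistent n ds s → Consistent n ds t → s ≡ t
consistent-unique [] [] _ _ = refl
consistent-unique [] (_ ∷ _) cs ct =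
  contradiction (Consistent-agree cs ct ≤-refl (inj₂ ≤-refl) (inj₂ ≤-refl)) λ ()
consistent-unique (_ ∷ _) [] cs ct =
  contradiction (Consistent-agree ct cs ≤-refl (inj₂ ≤-refl) (inj₂ ≤-refl)) λ ()
consistent-unique {n} s@(_ ∷ _) t@(_ ∷ _) cs@(s≤n , _) ct@(t≤n , _) =
  splitCost-injective pos≡ neg≡ below≡
  where
  splitCost≡ : ∀ {k} → k ≤ n → Determined n s k → Determined n t k → splitCost k s ≡ splitCost k t
  splitCost≡ k≤n detS detT = toℚ-injective (just-injective (Consistent-agree cs ct k≤n detS detT))
  pos≡ : uniformCost pos s ≡ uniformCost pos t
  pos≡ = splitCost≡ z≤n (inj₁ (s≤s z≤n)) (inj₁ (s≤s z≤n))
  neg≡ : uniformCost neg s ≡ uniformCost neg t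
  neg≡ = begin
    uniformCost neg s ≡⟨ splitCost-≥length n s s≤n ⟨
    splitCost n s     ≡⟨ splitCost≡ ≤-refl (inj₂ ≤-refl) (inj₂ ≤-refl) ⟩
    splitCost n t     ≡⟨ splitCost-≥length n t t≤n ⟩
    uniformCost neg t ∎
    where open ≡-Reasoning
  below≡ : ∀ k → k < length s → k < length t → splitCost k s ≡ splitCost k t
  below≡ k k<s k<t = splitCost≡ (<⇒≤ (≤-trans k<s s≤n)) (inj₁ k<s) (inj₁ k<t)

listsUpTo : ℕ → List (List Bool)
listsUpTo zero = [] ∷ []
listsUpTo (suc n) = [] ∷ map (true ∷_) (listsUpTo n) ++ map (false ∷_) (listsUpTo n)

∈-listsUpTo : ∀ {n} s → length s ≤ n → s ∈ listsUpTo n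
∈-listsUpTo {zero} [] _ = here refl
∈-listsUpTo {suc n} [] _ = here refl
∈-listsUpTo {suc n} (true ∷ s) (s≤s s≤n) = there (∈-++⁺ˡ (∈-map⁺ (true ∷_) (∈-listsUpTo s s≤n)))
∈-listsUpTo {suc n} (false ∷ s) (s≤s s≤n) =
  there (∈-++⁺ʳ (map (true ∷_) (listsUpTo n)) (∈-map⁺ (false ∷_) (∈-listsUpTo s s≤n)))

find-unique : ∀ {A : Set} {p} {P : Pred A p} (P? : Decidable P) {xs s} →
              s ∈ xs → P s → (∀ {t} → P t → t ≡ s) → find P? xs ≡ just s
find-unique P? {x ∷ _} (here refl) Ps _ with P? x
... | yes _  = refl
... | no ¬Ps = contradiction Ps ¬Ps
find-unique P? {x ∷ _} (there s∈xs) Ps unique with P? x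
... | yes Px = cong just (unique Px)
... | no _   = find-unique P? s∈xs Ps unique

decode : (n : ℕ) → (Fin (n + 2) → Maybe ℚ) → List Bool
decode n ds = fromMaybe [] (find (consistent? n ds) (listsUpTo n))

decode-correct : ∀ {n ds s} → Consistent n ds s → decode n ds ≡ s
decode-correct {n} {ds} {s} cs =
  cong (fromMaybe []) (find-unique (consistent? n ds) (∈-listsUpTo s (proj₁ cs)) cs
                                   (λ {t} ct → consistent-unique t s ct cs))

extraLetters : List ℚ
extraLetters = map mark (neg ∷ pos ∷ [])

mark∈extraLetters : ∀ m → mark m ∈ extraLetters
mark∈extraLetters neg = here refl
mark∈extraLetters pos = there (here refl)

mainTheorem14 :
    Σ ℕ λ C → ∀ (n : ℕ) → 1 ≤ n →
      Σ (Fin (n + 2) → List ℚ) λ Q →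
        (∀ i → length (Q i) ≤ n) ×
        (Σ (List ℚ) λ E → length E ≤ C ×
          (∀ i → All (λ c → c ≡ 0ℚ ⊎ c ≡ 1ℚ ⊎ c ∈ E) (Q i))) ×
        (Σ ((Fin (n + 2) → Maybe ℚ) → List Bool) λ dec →
          ∀ (s : List Bool) → length s ≤ n →
          ∀ (ds : Fin (n + 2) → Maybe ℚ) →
          (∀ i → IsDTW (toSeq s) (Q i) (ds i)) →
          dec ds ≡ s)
mainTheorem14 = 2 , λ n 1≤n →
  (λ i → map mark (query n (toℕ i))) ,
  (λ i → subst (_≤ n) (sym (length-map mark (query n (toℕ i)))) (length-query≤ (toℕ i) 1≤n)) ,
  (extraLetters , ≤-refl ,
   λ i → map⁺ (universal (λ m → inj₂ (inj₂ (mark∈extraLetters m))) (query n (toℕ i)))) ,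
  decode n ,
  λ s s≤n ds dtw → decode-correct (DTW-consistent ds s≤n dtw)
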